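{- If a weighted tripartite graph $(G,w)$ is extremal and vertex minimal, then $|A|,|B|,|C|\le3$.
   Context: A tripartite graph is a finite graph $G=(V,E)$ with a fixed partition $V=A\dot\cup B\dot\cup C$ into three nonempty independent sets. A weighted tripartite graph $(G,w)$ has $w:V\to[0,1]$ with the weights in each class summing to $1$; edge densities $\alpha(G,w)=\sum_{bc\in E,b\in B,c\in C}w(b)w(c)$, $\beta(G,w)=\sum_{ac\in E,a\in A,c\in C}w(a)w(c)$, $\gamma(G,w)=\sum_{ab\in E,a\in A,b\in B}w(a)w(b)$; triangle density $t(G,w)=\sum w(a)w(b)w(c)$ over pairwise adjacent triples $a\in A,b\in B,c\in C$. $\mathbf{Tri}(\alpha,\beta,\gamma)$ is the set of weighted tripartite graphs with edge densities $\alpha,\beta,\gamma$ and $T_{\min}(\alpha,\beta,\gamma)=\min_{(G,w)\in\mathbf{Tri}(\alpha,\beta,\gamma)}t(G,w)$. $(G,w)\in\mathbf{Tri}(\alpha,\beta,\gamma)$ is extremal if $t(G,w)=T_{\min}(\alpha,\beta,\gamma)$, and vertex minimal if there is no $(G',w')\in\mathbf{Tri}(\alpha,\beta,\gamma)$ with $t(G',w')=t(G,w)$ and $|V(G')|<|V(G)|$. -}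

module Defs where

open import Data.Nat using (ℕ; zero; suc; NonZero)
import Data.Nat as ℕ
open import Data.Fin using (Fin; zero; suc)
open import Data.Bool using (Bool; true; false; if_then_else_; _∧_)
open import Data.Product using (Σ; ∃; _×_; _,_)
open import Relation.Binary.PropositionalEquality using (_≡_)
open import Relation.Nullary using (¬_)
import Algebra.Structures as AS
import Relation.Binary.Structures as RS

-- The real numbers, axiomatised as a complete ordered field
-- (unique up to isomorphism; the theorem is quantified over all of them).

record RealField : Set₁ where
  infixl 6 _+_
  infixl 7 _*_
  infix 4 _≤_
  field
    ℝ : Set
    _+_ _*_ : ℝ → ℝ → ℝ
    -_ : ℝ → ℝ
    0# 1# : ℝ
    _≤_ : ℝ → ℝ → Set
    isCommutativeRing : AS.IsCommutativeRing _≡_ _+_ _*_ -_ 0# 1#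
    isTotalOrder : RS.IsTotalOrder _≡_ _≤_
    0≢1 : ¬ (0# ≡ 1#)
    inverse : ∀ x → ¬ (x ≡ 0#) → Σ ℝ (λ y → x * y ≡ 1#)
    +-mono-≤ : ∀ {x y} z → x ≤ y → x + z ≤ y + z
    *-nonneg : ∀ {x y} → 0# ≤ x → 0# ≤ y → 0# ≤ x * y
    sup : (P : ℝ → Set) → Σ ℝ P → Σ ℝ (λ u → ∀ x → P x → x ≤ u) →
          Σ ℝ (λ s → (∀ x → P x → x ≤ s) ×
                     (∀ u → (∀ x → P x → x ≤ u) → s ≤ u))

module _ (R : RealField) where
  open RealField R

  Σ[_] : (n : ℕ) → (Fin n → ℝ) → ℝ
  Σ[ zero ] f = 0#
  Σ[ suc n ] f = f zero + Σ[ n ] (λ i → f (suc i))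

  record Weight (n : ℕ) : Set where
    field
      w : Fin n → ℝ
      w-nonneg : ∀ i → 0# ≤ w i
      w-le1 : ∀ i → w i ≤ 1#
      w-sum : Σ[ n ] w ≡ 1#

  -- A weighted tripartite graph with classes A = Fin a, B = Fin b, C = Fin c
  -- (nonempty, independent); edges only between distinct classes,
  -- given by Boolean adjacency matrices.
  record WTG : Set where
    field
      a b c : ℕ
      a≢0 : NonZero a
      b≢0 : NonZero b
      c≢0 : NonZero c
      AB : Fin a → Fin b → Bool
      AC : Fin a → Fin c → Bool
      BC : Fin b → Fin c → Bool
      wA : Weight a
      wB : Weight b
      wC : Weight c

  module _ (G : WTG) where
    open WTG G
    open Weight wA renaming (w to xA)
    open Weight wB renaming (w to xB)
    open Weight wC renaming (w to xC)

    private
      [_]·_ : Bool → ℝ → ℝ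
      [ e ]· r = if e then r else 0#

    size : ℕ
    size = a ℕ.+ b ℕ.+ c

    α : ℝ
    α = Σ[ b ] (λ j → Σ[ c ] (λ k → [ BC j k ]· (xB j * xC k)))

    β : ℝ
    β = Σ[ a ] (λ i → Σ[ c ] (λ k → [ AC i k ]· (xA i * xC k)))

    γ : ℝ
    γ = Σ[ a ] (λ i → Σ[ b ] (λ j → [ AB i j ]· (xA i * xB j)))

    t : ℝ
    t = Σ[ a ] (λ i → Σ[ b ] (λ j → Σ[ c ] (λ k →
          [ AB i j ∧ AC i k ∧ BC j k ]· (xA i * xB j * xC k))))

  InTri : ℝ → ℝ → ℝ → WTG → Set
  InTri x y z G = (α G ≡ x) × (β G ≡ y) × (γ G ≡ z)

  Extremal : WTG → Set
  Extremal G = ∀ G' → InTri (α G) (β G) (γ G) G' → t G ≤ t G'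

  VertexMinimal : WTG → Set
  VertexMinimal G = ¬ (Σ WTG (λ G' → InTri (α G) (β G) (γ G) G' ×
                                       (t G' ≡ t G) × (size G' ℕ.< size G)))

module Submission where

-- For a vertex i of A let degC i and degB i be the weights of its neighbourhoods in C and B, and
-- linkDensity i the density of its link; β, γ and t are the averages of these over A.  If |A| ≥ 4,
-- the vectors (1, degC i, degB i) ∈ ℝ³ are linearly dependent, so some nonzero direction d for the
-- weights of A preserves the total weight, β and γ; its sign can be chosen so that t does not
-- increase along d.  Moving the weights along d until a vertex of A loses all its weight stays in
-- Tri(α, β, γ) without increasing t, so by extremality t is unchanged, and deleting the weightless
-- vertex contradicts vertex minimality.  B and C follow by rotating the three classes.  The case
-- distinctions on real numbers happen in the double-negation monad, which suffices because
-- |A| ≤ 3 is decidable.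

open import Defs
open import Data.Nat using (_≤_)
open import Data.Product using (_×_)

open import Algebra.Bundles using (CommutativeRing)
import Algebra.Solver.Ring as RingSolver
open import Algebra.Solver.Ring.AlmostCommutativeRing
  using (fromCommutativeRing; _-Raw-AlmostCommutative⟶_)
open import Data.Bool using (Bool; true; false; if_then_else_; _∧_)
import Data.Bool.Properties as Bool
open import Data.Fin using (Fin; zero; suc; punchIn)
open import Data.Integer as ℤ using (ℤ; -[1+_]; _⊖_)
import Data.Integer.Properties as ℤ
open import Data.Maybe using (Maybe; just; nothing)
open import Data.Nat as ℕ using (ℕ; zero; suc)
import Data.Nat.Properties as ℕ
open import Data.Product as Product using (Σ; ∃; _,_; proj₁)
open import Data.Sum as Sum using (_⊎_; inj₁; inj₂)
open import Data.Vec.Functional using (_∷_; []; insertAt; removeAt)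
open import Data.Vec.Functional.Properties using (insertAt-lookup; insertAt-punchIn)
open import Effect.Monad using (RawMonad)
open import Function using (_∘_; id)
open import Level using (0ℓ)
open import Relation.Binary.Bundles using (Poset)
import Relation.Binary.Reasoning.PartialOrder as PartialOrderReasoning
import Relation.Binary.Structures as RS
open import Relation.Binary.PropositionalEquality
  using (_≡_; _≢_; refl; sym; trans; cong; cong₂; subst; subst₂; module ≡-Reasoning)
open import Relation.Nullary using (¬_; Dec; yes; no)
open import Relation.Nullary.Decidable using (¬¬-excluded-middle)
open import Relation.Nullary.Negation using (¬¬-Monad; ¬¬-map; ¬∃⟶∀¬; contradiction)

open RawMonad (¬¬-Monad {0ℓ}) using (_>>=_; pure)

¬¬-∀-Fin : ∀ {n} {P : Fin n → Set} → (∀ i → ¬ ¬ P i) → ¬ ¬ (∀ i → P i)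
¬¬-∀-Fin {zero}  _   = pure λ ()
¬¬-∀-Fin {suc n} ¬¬P = do
  p₀ ← ¬¬P zero
  p₊ ← ¬¬-∀-Fin (¬¬P ∘ suc)
  pure λ { zero → p₀ ; (suc i) → p₊ i }

module _ (R : RealField) where
  open RealField R renaming (_≤_ to _≤ᵣ_)

  commutativeRing : CommutativeRing _ _
  commutativeRing = record { isCommutativeRing = isCommutativeRing }

  open CommutativeRing commutativeRing
    using ( +-assoc; +-comm; +-identityˡ; +-identityʳ; -‿inverseʳ
          ; *-assoc; *-comm; *-identityˡ; *-identityʳ; zeroˡ; zeroʳ; semiring; ring)
  open import Algebra.Properties.Ring ring using (-0#≈0#; -‿involutive; -‿distribˡ-*; -‿distribʳ-*; -‿+-comm)
  open import Algebra.Properties.Semiring.Mult semiring using (×-homo-+; ×1-homo-*)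
    renaming (_×_ to _·_)

  -- The ring solver needs coefficients with a decidable equality; ℤ embeds into ℝ via ⟦_⟧.
  ⟦_⟧ : ℤ → ℝ
  ⟦ ℤ.+ n ⟧ = n · 1#
  ⟦ -[1+ n ] ⟧ = - (suc n · 1#)

  private
    ⟦-⟧-homo : ∀ i → ⟦ ℤ.- i ⟧ ≡ - ⟦ i ⟧
    ⟦-⟧-homo (ℤ.+ zero) = sym -0#≈0#
    ⟦-⟧-homo ℤ.+[1+ n ] = refl
    ⟦-⟧-homo -[1+ n ] = sym (-‿involutive _)

    ⟦⊖⟧-homo : ∀ m n → ⟦ m ⊖ n ⟧ ≡ m · 1# + - (n · 1#)
    ⟦⊖⟧-homo zero zero = sym (trans (cong (0# +_) -0#≈0#) (+-identityʳ 0#))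
    ⟦⊖⟧-homo zero (suc n) = sym (+-identityˡ _)
    ⟦⊖⟧-homo (suc m) zero = sym (trans (cong (suc m · 1# +_) -0#≈0#) (+-identityʳ _))
    ⟦⊖⟧-homo (suc m) (suc n) = begin
      ⟦ suc m ⊖ suc n ⟧                          ≡⟨ cong ⟦_⟧ (ℤ.[1+m]⊖[1+n]≡m⊖n m n) ⟩
      ⟦ m ⊖ n ⟧                                  ≡⟨ ⟦⊖⟧-homo m n ⟩
      a + - b                                    ≡⟨ cong (_+ - b) (+-identityˡ a) ⟨
      (0# + a) + - b                             ≡⟨ cong (λ z → (z + a) + - b) (-‿inverseʳ 1#) ⟨
      ((1# + - 1#) + a) + - b                    ≡⟨ cong (_+ - b) (+-assoc 1# (- 1#) a) ⟩
      (1# + (- 1# + a)) + - b                    ≡⟨ cong (λ z → (1# + z) + - b) (+-comm (- 1#) a) ⟩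
      (1# + (a + - 1#)) + - b                    ≡⟨ cong (_+ - b) (+-assoc 1# a (- 1#)) ⟨
      ((1# + a) + - 1#) + - b                    ≡⟨ +-assoc (1# + a) (- 1#) (- b) ⟩
      (1# + a) + (- 1# + - b)                    ≡⟨ cong ((1# + a) +_) (-‿+-comm 1# b) ⟩
      (1# + a) + - (1# + b)                      ∎
      where
      open ≡-Reasoning
      a b : ℝ
      a = m · 1#
      b = n · 1#

    ⟦+⟧-homo : ∀ i j → ⟦ i ℤ.+ j ⟧ ≡ ⟦ i ⟧ + ⟦ j ⟧
    ⟦+⟧-homo (ℤ.+ m) (ℤ.+ n) = ×-homo-+ 1# m n
    ⟦+⟧-homo (ℤ.+ m) -[1+ n ] = ⟦⊖⟧-homo m (suc n)
    ⟦+⟧-homo -[1+ m ] (ℤ.+ n) = trans (⟦⊖⟧-homo n (suc m)) (+-comm _ _)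
    ⟦+⟧-homo -[1+ m ] -[1+ n ] = begin
      ⟦ -[1+ m ] ℤ.+ -[1+ n ] ⟧                  ≡⟨ cong ⟦_⟧ (ℤ.neg-distrib-+ ℤ.+[1+ m ] ℤ.+[1+ n ]) ⟨
      ⟦ ℤ.- (ℤ.+[1+ m ] ℤ.+ ℤ.+[1+ n ]) ⟧              ≡⟨ ⟦-⟧-homo (ℤ.+ (suc m ℕ.+ suc n)) ⟩
      - ((suc m ℕ.+ suc n) · 1#)                 ≡⟨ cong -_ (×-homo-+ 1# (suc m) (suc n)) ⟩
      - (suc m · 1# + suc n · 1#)                ≡⟨ -‿+-comm _ _ ⟨
      ⟦ -[1+ m ] ⟧ + ⟦ -[1+ n ] ⟧                ∎
      where open ≡-Reasoning

    ⟦*⟧-homo⁺ : ∀ m j → ⟦ ℤ.+ m ℤ.* j ⟧ ≡ ⟦ ℤ.+ m ⟧ * ⟦ j ⟧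
    ⟦*⟧-homo⁺ m (ℤ.+ n) = trans (cong ⟦_⟧ (sym (ℤ.pos-* m n))) (×1-homo-* m n)
    ⟦*⟧-homo⁺ m -[1+ n ] = begin
      ⟦ ℤ.+ m ℤ.* ℤ.- ℤ.+[1+ n ] ⟧                  ≡⟨ cong ⟦_⟧ (ℤ.neg-distribʳ-* (ℤ.+ m) ℤ.+[1+ n ]) ⟨
      ⟦ ℤ.- (ℤ.+ m ℤ.* ℤ.+[1+ n ]) ⟧                  ≡⟨ ⟦-⟧-homo (ℤ.+ m ℤ.* ℤ.+[1+ n ]) ⟩
      - ⟦ ℤ.+ m ℤ.* ℤ.+[1+ n ] ⟧                      ≡⟨ cong -_ (⟦*⟧-homo⁺ m ℤ.+[1+ n ]) ⟩
      - (⟦ ℤ.+ m ⟧ * ⟦ ℤ.+[1+ n ] ⟧)                  ≡⟨ -‿distribʳ-* _ _ ⟩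
      ⟦ ℤ.+ m ⟧ * ⟦ -[1+ n ] ⟧                     ∎
      where open ≡-Reasoning

    ⟦*⟧-homo : ∀ i j → ⟦ i ℤ.* j ⟧ ≡ ⟦ i ⟧ * ⟦ j ⟧
    ⟦*⟧-homo (ℤ.+ m) j = ⟦*⟧-homo⁺ m j
    ⟦*⟧-homo -[1+ m ] j = begin
      ⟦ ℤ.- ℤ.+[1+ m ] ℤ.* j ⟧                    ≡⟨ cong ⟦_⟧ (ℤ.neg-distribˡ-* ℤ.+[1+ m ] j) ⟨
      ⟦ ℤ.- (ℤ.+[1+ m ] ℤ.* j) ⟧                    ≡⟨ ⟦-⟧-homo (ℤ.+[1+ m ] ℤ.* j) ⟩
      - ⟦ ℤ.+[1+ m ] ℤ.* j ⟧                        ≡⟨ cong -_ (⟦*⟧-homo⁺ (suc m) j) ⟩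
      - (⟦ ℤ.+[1+ m ] ⟧ * ⟦ j ⟧)                    ≡⟨ -‿distribˡ-* _ _ ⟩
      ⟦ -[1+ m ] ⟧ * ⟦ j ⟧                       ∎
      where open ≡-Reasoning

    ℤ⟶ℝ : ℤ.+-*-rawRing -Raw-AlmostCommutative⟶ fromCommutativeRing commutativeRing
    ℤ⟶ℝ = record
      { ⟦_⟧ = ⟦_⟧ ; +-homo = ⟦+⟧-homo ; *-homo = ⟦*⟧-homo ; -‿homo = ⟦-⟧-homo
      ; 0-homo = refl ; 1-homo = +-identityʳ 1# }

    ⟦⟧-weaklyDecidable : ∀ i j → Maybe (⟦ i ⟧ ≡ ⟦ j ⟧)
    ⟦⟧-weaklyDecidable i j with i ℤ.≟ j
    ... | yes refl = just refl
    ... | no _ = nothing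

  open RingSolver ℤ.+-*-rawRing (fromCommutativeRing commutativeRing) ℤ⟶ℝ ⟦⟧-weaklyDecidable
    using (solve; _:+_; _:*_; :-_; _:-_; _:=_; con)
  open import Algebra.Properties.Semiring.Sum semiring
    using (sum; sum-cong-≗; ∑-distrib-+; *-distribˡ-sum; *-distribʳ-sum; sum-remove; ∑-comm; sum-replicate-zero)

  open RS.IsTotalOrder isTotalOrder using (total; antisym)
    renaming (refl to ≤-refl; trans to ≤-trans; reflexive to ≤-reflexive)

  ≤-poset : Poset _ _ _
  ≤-poset = record { isPartialOrder = RS.IsTotalOrder.isPartialOrder isTotalOrder }

  module ≤-Reasoning = PartialOrderReasoning ≤-poset

  +-monoʳ-≤ : ∀ z {x y} → x ≤ᵣ y → z + x ≤ᵣ z + y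
  +-monoʳ-≤ z {x} {y} x≤y = subst₂ _≤ᵣ_ (+-comm x z) (+-comm y z) (+-mono-≤ z x≤y)

  +-nonneg : ∀ {x y} → 0# ≤ᵣ x → 0# ≤ᵣ y → 0# ≤ᵣ x + y
  +-nonneg {x} {y} 0≤x 0≤y = begin
    0#      ≤⟨ 0≤x ⟩
    x       ≡⟨ +-identityʳ x ⟨
    x + 0#  ≤⟨ +-monoʳ-≤ x 0≤y ⟩
    x + y   ∎
    where open ≤-Reasoning

  neg-antimono-≤ : ∀ {x y} → x ≤ᵣ y → - y ≤ᵣ - x
  neg-antimono-≤ {x} {y} x≤y = begin
    - y                ≡⟨ solve 2 (λ x y → :- y := x :+ (:- x :- y)) refl x y ⟩
    x + (- x + - y)    ≤⟨ +-mono-≤ (- x + - y) x≤y ⟩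
    y + (- x + - y)    ≡⟨ solve 2 (λ x y → y :+ (:- x :- y) := :- x) refl x y ⟩
    - x                ∎
    where open ≤-Reasoning

  neg-nonpos : ∀ {x} → x ≤ᵣ 0# → 0# ≤ᵣ - x
  neg-nonpos x≤0 = subst (_≤ᵣ _) -0#≈0# (neg-antimono-≤ x≤0)

  neg-nonneg : ∀ {x} → 0# ≤ᵣ x → - x ≤ᵣ 0#
  neg-nonneg 0≤x = subst (_ ≤ᵣ_) -0#≈0# (neg-antimono-≤ 0≤x)

  *-monoˡ-≤-nonneg : ∀ {c x y} → 0# ≤ᵣ c → x ≤ᵣ y → c * x ≤ᵣ c * y
  *-monoˡ-≤-nonneg {c} {x} {y} 0≤c x≤y = begin
    c * x                          ≡⟨ +-identityˡ (c * x) ⟨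
    0# + c * x                     ≤⟨ +-mono-≤ (c * x) (*-nonneg 0≤c 0≤y-x) ⟩
    c * (y + - x) + c * x          ≡⟨ solve 3 (λ c x y → c :* (y :- x) :+ c :* x := c :* y) refl c x y ⟩
    c * y                          ∎
    where
    open ≤-Reasoning
    0≤y-x : 0# ≤ᵣ y + - x
    0≤y-x = subst (_≤ᵣ y + - x) (-‿inverseʳ x) (+-mono-≤ (- x) x≤y)

  *-monoʳ-≤-nonpos : ∀ {c x y} → c ≤ᵣ 0# → x ≤ᵣ y → y * c ≤ᵣ x * c
  *-monoʳ-≤-nonpos {c} {x} {y} c≤0 x≤y = begin
    y * c         ≡⟨ solve 2 (λ c y → y :* c := :- (:- c :* y)) refl c y ⟩
    - (- c * y)   ≤⟨ neg-antimono-≤ (*-monoˡ-≤-nonneg (neg-nonpos c≤0) x≤y) ⟩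
    - (- c * x)   ≡⟨ solve 2 (λ c x → :- (:- c :* x) := x :* c) refl c x ⟩
    x * c         ∎
    where open ≤-Reasoning

  *-nonneg-nonpos : ∀ {x y} → 0# ≤ᵣ x → y ≤ᵣ 0# → x * y ≤ᵣ 0#
  *-nonneg-nonpos {x} {y} 0≤x y≤0 =
    subst (x * y ≤ᵣ_) (zeroˡ y) (*-monoʳ-≤-nonpos y≤0 0≤x)

  0≤1 : 0# ≤ᵣ 1#
  0≤1 with total 0# 1#
  ... | inj₁ 0≤1 = 0≤1
  ... | inj₂ 1≤0 = subst₂ _≤ᵣ_ (zeroˡ 1#) (*-identityˡ 1#) (*-monoʳ-≤-nonpos 1≤0 1≤0)

  -‿nonzero : ∀ {x} → x ≢ 0# → - x ≢ 0#
  -‿nonzero {x} x≢0 -x≡0 = x≢0 (begin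
    x        ≡⟨ -‿involutive x ⟨
    - - x    ≡⟨ cong -_ -x≡0 ⟩
    - 0#     ≡⟨ -0#≈0# ⟩
    0#       ∎)
    where open ≡-Reasoning

  *-nonzero : ∀ {x y} → x ≢ 0# → y ≢ 0# → x * y ≢ 0#
  *-nonzero {x} {y} x≢0 y≢0 xy≡0 with inverse x x≢0
  ... | x⁻¹ , xx⁻¹≡1 = y≢0 (begin
    y                 ≡⟨ *-identityˡ y ⟨
    1# * y            ≡⟨ cong (_* y) xx⁻¹≡1 ⟨
    x * x⁻¹ * y       ≡⟨ solve 3 (λ x x⁻¹ y → x :* x⁻¹ :* y := x⁻¹ :* (x :* y)) refl x x⁻¹ y ⟩
    x⁻¹ * (x * y)     ≡⟨ cong (x⁻¹ *_) xy≡0 ⟩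
    x⁻¹ * 0#          ≡⟨ zeroʳ x⁻¹ ⟩
    0#                ∎)
    where open ≡-Reasoning

  inverse-nonneg : ∀ {x} → 0# ≤ᵣ x → x ≢ 0# → Σ ℝ λ y → x * y ≡ 1# × 0# ≤ᵣ y
  inverse-nonneg {x} 0≤x x≢0 with inverse x x≢0
  ... | y , xy≡1 with total 0# y
  ...   | inj₁ 0≤y = y , xy≡1 , 0≤y
  ...   | inj₂ y≤0 = contradiction (antisym 0≤1 (subst (_≤ᵣ 0#) xy≡1 (*-nonneg-nonpos 0≤x y≤0))) 0≢1

  Σ≡sum : ∀ n (f : Fin n → ℝ) → Σ[_] R n f ≡ sum f
  Σ≡sum zero f = refl
  Σ≡sum (suc n) f = cong (f zero +_) (Σ≡sum n (f ∘ suc))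

  sum-nonneg : ∀ {n} (f : Fin n → ℝ) → (∀ i → 0# ≤ᵣ f i) → 0# ≤ᵣ sum f
  sum-nonneg {zero} f _ = ≤-refl
  sum-nonneg {suc n} f f≥0 = +-nonneg (f≥0 zero) (sum-nonneg (f ∘ suc) (f≥0 ∘ suc))

  summand≤sum : ∀ {n} (f : Fin n → ℝ) → (∀ i → 0# ≤ᵣ f i) → ∀ i → f i ≤ᵣ sum f
  summand≤sum {suc n} f f≥0 i = begin
    f i                          ≡⟨ +-identityʳ (f i) ⟨
    f i + 0#                     ≤⟨ +-monoʳ-≤ (f i) (sum-nonneg (removeAt f i) (f≥0 ∘ punchIn i)) ⟩
    f i + sum (removeAt f i)     ≡⟨ sum-remove f ⟨
    sum f                        ∎
    where open ≤-Reasoning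

  sum-linear : ∀ {n} (x d v : Fin n → ℝ) s →
    sum (λ i → (x i + s * d i) * v i) ≡ sum (λ i → x i * v i) + s * sum (λ i → d i * v i)
  sum-linear x d v s = begin
    sum (λ i → (x i + s * d i) * v i)
      ≡⟨ sum-cong-≗ (λ i → solve 4 (λ x s d v → (x :+ s :* d) :* v := x :* v :+ s :* (d :* v))
                                 refl (x i) s (d i) (v i)) ⟩
    sum (λ i → x i * v i + s * (d i * v i))
      ≡⟨ ∑-distrib-+ (λ i → x i * v i) (λ i → s * (d i * v i)) ⟩
    sum (λ i → x i * v i) + sum (λ i → s * (d i * v i))
      ≡⟨ cong (sum (λ i → x i * v i) +_) (*-distribˡ-sum s (λ i → d i * v i)) ⟨
    sum (λ i → x i * v i) + s * sum (λ i → d i * v i) ∎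
    where open ≡-Reasoning

  -- Linear dependence

  allZero⊎nonzero : ∀ {n} (x : Fin n → ℝ) → ¬ ¬ ((∀ i → x i ≡ 0#) ⊎ ∃ λ i → x i ≢ 0#)
  allZero⊎nonzero x = ¬¬-excluded-middle >>= λ where
    (yes nonzero)  → pure (inj₂ nonzero)
    (no ¬nonzero) → ¬¬-map inj₁ (¬¬-∀-Fin (¬∃⟶∀¬ ¬nonzero))

  zeroSum⇒negativeEntry : ∀ {n} (d : Fin n → ℝ) → sum d ≡ 0# → ∀ k → d k ≢ 0# →
                  ¬ ¬ ∃ λ j → d j ≤ᵣ 0# × d j ≢ 0#
  zeroSum⇒negativeEntry d Σd≡0 k dk≢0 ¬negative = ¬¬-∀-Fin nonneg λ d≥0 →
    dk≢0 (antisym (subst (d k ≤ᵣ_) Σd≡0 (summand≤sum d d≥0 k)) (d≥0 k))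
    where
    nonneg : ∀ j → ¬ ¬ (0# ≤ᵣ d j)
    nonneg j ¬0≤dj with total (d j) 0#
    ... | inj₁ dj≤0 = ¬negative (j , dj≤0 , λ dj≡0 → ¬0≤dj (≤-reflexive (sym dj≡0)))
    ... | inj₂ 0≤dj = ¬0≤dj 0≤dj

  NontrivialRelation : ∀ {m n} → (Fin n → Fin m → ℝ) → Set
  NontrivialRelation {m} {n} v =
    Σ (Fin n → ℝ) λ d → (∃ λ i → d i ≢ 0#) × (∀ c → sum (λ i → d i * v i c) ≡ 0#)

  elimination-identity : ∀ {n} (e x y : Fin n → ℝ) (x₀ y₀ : ℝ) →
    - sum (λ j → e j * x j) * y₀ + sum (λ j → x₀ * e j * y j) ≡
    sum (λ j → e j * (x₀ * y j + - (x j * y₀)))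
  elimination-identity e x y x₀ y₀ = begin
    - S * y₀ + T
      ≡⟨ cong (_+ T) (solve 2 (λ S y₀ → :- S :* y₀ := S :* (:- y₀)) refl S y₀) ⟩
    S * - y₀ + T
      ≡⟨ cong (_+ T) (*-distribʳ-sum (- y₀) (λ j → e j * x j)) ⟩
    sum (λ j → e j * x j * - y₀) + T
      ≡⟨ ∑-distrib-+ (λ j → e j * x j * - y₀) (λ j → x₀ * e j * y j) ⟨
    sum (λ j → e j * x j * - y₀ + x₀ * e j * y j)
      ≡⟨ sum-cong-≗ (λ j → solve 5 (λ e x y x₀ y₀ → e :* x :* (:- y₀) :+ x₀ :* e :* y
                                                   := e :* (x₀ :* y :- x :* y₀))
                                   refl (e j) (x j) (y j) x₀ y₀) ⟩
    sum (λ j → e j * (x₀ * y j + - (x j * y₀))) ∎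
    where
    open ≡-Reasoning
    S T : ℝ
    S = sum (λ j → e j * x j)
    T = sum (λ j → x₀ * e j * y j)

  <⇒nontrivialRelation : ∀ {m n} → m ℕ.< n → (v : Fin n → Fin m → ℝ) → ¬ ¬ NontrivialRelation v
  <⇒nontrivialRelation {zero} {suc n} _ v = pure ((λ _ → 1#) , (zero , 0≢1 ∘ sym) , λ ())
  <⇒nontrivialRelation {suc m} {suc n} (ℕ.s≤s m<n) v = allZero⊎nonzero x >>= reduce
    where
    x : Fin (suc n) → ℝ
    x i = v i zero

    extend : (∀ i → x i ≡ 0#) → NontrivialRelation (λ i c → v i (suc c)) → NontrivialRelation v
    extend x≡0 (d , nonzero , relation) = d , nonzero , λ where
      zero    → trans (sum-cong-≗ λ i → trans (cong (d i *_) (x≡0 i)) (zeroʳ (d i)))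
                      (sum-replicate-zero (suc n))
      (suc c) → relation c

    -- Gaussian elimination of the first coordinate against the pivot vector v k.
    eliminate : Fin (suc n) → Fin n → Fin (suc m) → ℝ
    eliminate k j c = x k * v (punchIn k j) c + - (x (punchIn k j) * v k c)

    lift : ∀ k → x k ≢ 0# → NontrivialRelation (λ j c → eliminate k j (suc c)) → NontrivialRelation v
    lift k xk≢0 (e , (j , ej≢0) , relation) = d , (punchIn k j , dj≢0) , relation′
      where
      d : Fin (suc n) → ℝ
      d = insertAt (λ j → x k * e j) k (- sum (λ j → e j * x (punchIn k j)))

      dj≢0 : d (punchIn k j) ≢ 0#
      dj≢0 = subst (_≢ 0#) (sym (insertAt-punchIn _ k _ j)) (*-nonzero xk≢0 ej≢0)

      combination : ∀ c → sum (λ i → d i * v i c) ≡ sum (λ j → e j * eliminate k j c)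
      combination c = begin
        sum (λ i → d i * v i c)
          ≡⟨ sum-remove {i = k} (λ i → d i * v i c) ⟩
        d k * v k c + sum (λ j → d (punchIn k j) * v (punchIn k j) c)
          ≡⟨ cong₂ _+_ (cong (_* v k c) (insertAt-lookup _ k _))
                       (sum-cong-≗ λ j → cong (_* v (punchIn k j) c) (insertAt-punchIn _ k _ j)) ⟩
        - sum (λ j → e j * x (punchIn k j)) * v k c + sum (λ j → x k * e j * v (punchIn k j) c)
          ≡⟨ elimination-identity e (x ∘ punchIn k) (λ j → v (punchIn k j) c) (x k) (v k c) ⟩
        sum (λ j → e j * eliminate k j c) ∎
        where open ≡-Reasoning

      relation′ : ∀ c → sum (λ i → d i * v i c) ≡ 0#
      relation′ zero = trans (combination zero) (trans (sum-cong-≗ pivotless) (sum-replicate-zero n))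
        where
        pivotless : ∀ j → e j * eliminate k j zero ≡ 0#
        pivotless j =
          solve 3 (λ e a b → e :* (a :* b :- b :* a) := con (ℤ.+ 0)) refl (e j) (x k) (x (punchIn k j))
      relation′ (suc c) = trans (combination (suc c)) (relation c)

    reduce : (∀ i → x i ≡ 0#) ⊎ (∃ λ k → x k ≢ 0#) → ¬ ¬ NontrivialRelation v
    reduce (inj₁ x≡0) =
      ¬¬-map (extend x≡0) (<⇒nontrivialRelation (ℕ.m<n⇒m<1+n m<n) (λ i c → v i (suc c)))
    reduce (inj₂ (k , xk≢0)) =
      ¬¬-map (lift k xk≢0) (<⇒nontrivialRelation m<n (λ j c → eliminate k j (suc c)))

  -- Moving inside the nonnegative orthant

  nonneg-between : ∀ {a b s t} → 0# ≤ᵣ a → 0# ≤ᵣ a + s * b → 0# ≤ᵣ t → t ≤ᵣ s → 0# ≤ᵣ a + t * b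
  nonneg-between {a} {b} {s} {t} 0≤a 0≤a+sb 0≤t t≤s with total 0# b
  ... | inj₁ 0≤b = +-nonneg 0≤a (*-nonneg 0≤t 0≤b)
  ... | inj₂ b≤0 = ≤-trans 0≤a+sb (+-monoʳ-≤ a (*-monoʳ-≤-nonpos b≤0 t≤s))

  root-of-nonincreasing : ∀ {a b} → 0# ≤ᵣ a → b ≤ᵣ 0# → b ≢ 0# → Σ ℝ λ t → 0# ≤ᵣ t × a + t * b ≡ 0#
  root-of-nonincreasing {a} {b} 0≤a b≤0 b≢0 with inverse-nonneg (neg-nonpos b≤0) (-‿nonzero b≢0)
  ... | c , -b*c≡1 , 0≤c = a * c , *-nonneg 0≤a 0≤c , (begin
    a + a * c * b           ≡⟨ solve 3 (λ a b c → a :+ a :* c :* b := a :- a :* (:- b :* c)) refl a b c ⟩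
    a + - (a * (- b * c))   ≡⟨ cong (λ z → a + - (a * z)) -b*c≡1 ⟩
    a + - (a * 1#)          ≡⟨ cong (λ z → a + - z) (*-identityʳ a) ⟩
    a + - a                 ≡⟨ -‿inverseʳ a ⟩
    0#                      ∎)
    where open ≡-Reasoning

  root-between : ∀ {a b s} → 0# ≤ᵣ a → 0# ≤ᵣ s → a + s * b ≤ᵣ 0# →
                 ¬ ¬ Σ ℝ λ t → 0# ≤ᵣ t × t ≤ᵣ s × a + t * b ≡ 0#
  root-between {a} {b} {s} 0≤a 0≤s a+sb≤0 = ¬¬-map root ¬¬-excluded-middle
    where
    Root : Set
    Root = Σ ℝ λ t → 0# ≤ᵣ t × t ≤ᵣ s × a + t * b ≡ 0#

    atEnd : 0# ≤ᵣ a + s * b → Root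
    atEnd 0≤a+sb = s , 0≤s , ≤-refl , antisym a+sb≤0 0≤a+sb

    nondecreasing : 0# ≤ᵣ b → Root
    nondecreasing 0≤b = atEnd (+-nonneg 0≤a (*-nonneg 0≤s 0≤b))

    earliest : Σ ℝ (λ t → 0# ≤ᵣ t × a + t * b ≡ 0#) → Root
    earliest (t , 0≤t , root) with total t s
    ... | inj₁ t≤s = t , 0≤t , t≤s , root
    ... | inj₂ s≤t = atEnd (nonneg-between 0≤a (≤-reflexive (sym root)) 0≤s s≤t)

    root : Dec (b ≡ 0#) → Root
    root (yes b≡0) = nondecreasing (≤-reflexive (sym b≡0))
    root (no b≢0) with total 0# b
    ... | inj₁ 0≤b = nondecreasing 0≤b
    ... | inj₂ b≤0 = earliest (root-of-nonincreasing 0≤a b≤0 b≢0)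

  Fits : ∀ {n} → (Fin n → ℝ) → (Fin n → ℝ) → ℝ → Set
  Fits x d s = ∀ i → 0# ≤ᵣ x i + s * d i

  Hits : ∀ {n} → (Fin n → ℝ) → (Fin n → ℝ) → ℝ → Set
  Hits x d s = ∃ λ i → x i + s * d i ≡ 0#

  StoppingPoint : ∀ {n} → (Fin n → ℝ) → (Fin n → ℝ) → ℝ → Set
  StoppingPoint x d s = Σ ℝ λ t → 0# ≤ᵣ t × Fits x d t × (t ≡ s ⊎ Hits x d t)

  shrink-to-fit : ∀ {n} (x d : Fin n → ℝ) → (∀ i → 0# ≤ᵣ x i) → ∀ {s} → 0# ≤ᵣ s →
                  ¬ ¬ StoppingPoint x d s
  shrink-to-fit {zero} x d _ 0≤s = pure (_ , 0≤s , (λ ()) , inj₁ refl)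
  shrink-to-fit {suc n} x d x≥0 {s} 0≤s = shrink-to-fit (x ∘ suc) (d ∘ suc) (x≥0 ∘ suc) 0≤s >>= step
    where
    cons : ∀ {t} → 0# ≤ᵣ x zero + t * d zero → Fits (x ∘ suc) (d ∘ suc) t → Fits x d t
    cons fits₀ fits zero    = fits₀
    cons fits₀ fits (suc i) = fits i

    step : StoppingPoint (x ∘ suc) (d ∘ suc) s → ¬ ¬ StoppingPoint x d s
    step (t , 0≤t , fits , stop) with total 0# (x zero + t * d zero)
    ... | inj₁ fits₀        = pure (t , 0≤t , cons fits₀ fits , Sum.map₂ (Product.map suc id) stop)
    ... | inj₂ x₀+td₀≤0 = ¬¬-map lower (root-between (x≥0 zero) 0≤t x₀+td₀≤0)
      where
      lower : Σ ℝ (λ t′ → 0# ≤ᵣ t′ × t′ ≤ᵣ t × x zero + t′ * d zero ≡ 0#) → StoppingPoint x d s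
      lower (t′ , 0≤t′ , t′≤t , root) =
        t′ , 0≤t′ , cons (≤-reflexive (sym root)) (λ i → nonneg-between (x≥0 (suc i)) (fits i) 0≤t′ t′≤t)
           , inj₂ (zero , root)

  boundaryPoint : ∀ {n} (x d : Fin n → ℝ) → (∀ i → 0# ≤ᵣ x i) → ∀ k → d k ≤ᵣ 0# → d k ≢ 0# →
                  ¬ ¬ Σ ℝ λ s → 0# ≤ᵣ s × Fits x d s × Hits x d s
  boundaryPoint x d x≥0 k dk≤0 dk≢0 = startingFrom (root-of-nonincreasing (x≥0 k) dk≤0 dk≢0)
    where
    startingFrom : Σ ℝ (λ s → 0# ≤ᵣ s × x k + s * d k ≡ 0#) →
                   ¬ ¬ Σ ℝ λ t → 0# ≤ᵣ t × Fits x d t × Hits x d t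
    startingFrom (s , 0≤s , root) = ¬¬-map hit (shrink-to-fit x d x≥0 0≤s)
      where
      hit : StoppingPoint x d s → Σ ℝ λ t → 0# ≤ᵣ t × Fits x d t × Hits x d t
      hit (t , 0≤t , fits , inj₁ refl)  = t , 0≤t , fits , k , root
      hit (t , 0≤t , fits , inj₂ hits) = t , 0≤t , fits , hits

  -- Densities as averages over the class A

  -- The private [_]·_ of Defs, restated so that the densities unfold to terms that can be named here.
  [_]·_ : Bool → ℝ → ℝ
  [ e ]· r = if e then r else 0#

  [_]·-*ˡ : ∀ e x y → [ e ]· (x * y) ≡ x * [ e ]· y
  [ true  ]·-*ˡ x y = refl
  [ false ]·-*ˡ x y = sym (zeroʳ x)

  Σ-factorˡ : ∀ n x (f g : Fin n → ℝ) → (∀ i → f i ≡ x * g i) → Σ[_] R n f ≡ x * sum g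
  Σ-factorˡ n x f g f≡xg = begin
    Σ[_] R n f               ≡⟨ Σ≡sum n f ⟩
    sum f                    ≡⟨ sum-cong-≗ f≡xg ⟩
    sum (λ i → x * g i)      ≡⟨ *-distribˡ-sum x g ⟨
    x * sum g                ∎
    where open ≡-Reasoning

  Σ-cong : ∀ n {f g : Fin n → ℝ} → (∀ i → f i ≡ g i) → Σ[_] R n f ≡ Σ[_] R n g
  Σ-cong zero    f≡g = refl
  Σ-cong (suc n) f≡g = cong₂ _+_ (f≡g zero) (Σ-cong n (f≡g ∘ suc))

  Σ-comm : ∀ m n (f : Fin m → Fin n → ℝ) →
           Σ[_] R m (λ i → Σ[_] R n (f i)) ≡ Σ[_] R n (λ j → Σ[_] R m (λ i → f i j))
  Σ-comm m n f = begin
    Σ[_] R m (λ i → Σ[_] R n (f i))        ≡⟨ Σ²≡sum² m n f ⟩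
    sum (λ i → sum (f i))                  ≡⟨ ∑-comm f ⟩
    sum (λ j → sum (λ i → f i j))          ≡⟨ Σ²≡sum² n m (λ j i → f i j) ⟨
    Σ[_] R n (λ j → Σ[_] R m (λ i → f i j)) ∎
    where
    open ≡-Reasoning
    Σ²≡sum² : ∀ m n (f : Fin m → Fin n → ℝ) → Σ[_] R m (λ i → Σ[_] R n (f i)) ≡ sum (λ i → sum (f i))
    Σ²≡sum² m n f = trans (Σ≡sum m _) (sum-cong-≗ λ i → Σ≡sum n (f i))

  module _ (G : WTG R) where
    open WTG G

    xA : Fin a → ℝ
    xA = Weight.w wA

    degB degC linkDensity : Fin a → ℝ
    degB i = sum (λ j → [ AB i j ]· Weight.w wB j)
    degC i = sum (λ k → [ AC i k ]· Weight.w wC k)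
    linkDensity i = sum (λ j → sum (λ k → [ AB i j ∧ AC i k ∧ BC j k ]· (Weight.w wB j * Weight.w wC k)))

    β-by-vertex : β R G ≡ sum (λ i → xA i * degC i)
    β-by-vertex = trans (Σ≡sum a _) (sum-cong-≗ λ i →
      Σ-factorˡ c (xA i) _ _ λ k → [ AC i k ]·-*ˡ (xA i) _)

    γ-by-vertex : γ R G ≡ sum (λ i → xA i * degB i)
    γ-by-vertex = trans (Σ≡sum a _) (sum-cong-≗ λ i →
      Σ-factorˡ b (xA i) _ _ λ j → [ AB i j ]·-*ˡ (xA i) _)

    t-by-vertex : t R G ≡ sum (λ i → xA i * linkDensity i)
    t-by-vertex = trans (Σ≡sum a _) (sum-cong-≗ λ i →
      Σ-factorˡ b (xA i) _ _ λ j → Σ-factorˡ c (xA i) _ _ λ k →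
        trans (cong [ AB i j ∧ AC i k ∧ BC j k ]·_ (*-assoc (xA i) _ _)) ([ _ ]·-*ˡ (xA i) _))

    profile : Fin a → Fin 3 → ℝ
    profile i = 1# ∷ degC i ∷ degB i ∷ []

  Reducible : WTG R → Set
  Reducible G = Σ (WTG R) λ G′ →
    InTri R (α R G) (β R G) (γ R G) G′ × (t R G′ ≡ t R G) × (size R G′ ℕ.< size R G)

  reducible-via : ∀ {G G₁} → InTri R (α R G) (β R G) (γ R G) G₁ → t R G₁ ≡ t R G →
                  size R G₁ ≡ size R G → Reducible G₁ → Reducible G
  reducible-via (α≡ , β≡ , γ≡) t≡ size≡ (G₂ , (α₂≡ , β₂≡ , γ₂≡) , t₂≡ , smaller) =
    G₂ , (trans α₂≡ α≡ , trans β₂≡ β≡ , trans γ₂≡ γ≡) , trans t₂≡ t≡ , subst (size R G₂ ℕ.<_) size≡ smaller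

  sum-removeAt : ∀ {n} (f : Fin (suc n) → ℝ) i → f i ≡ 0# → sum (removeAt f i) ≡ sum f
  sum-removeAt f i fi≡0 = begin
    sum (removeAt f i)          ≡⟨ +-identityˡ _ ⟨
    0# + sum (removeAt f i)     ≡⟨ cong (_+ sum (removeAt f i)) fi≡0 ⟨
    f i + sum (removeAt f i)    ≡⟨ sum-remove f ⟨
    sum f                       ∎
    where open ≡-Reasoning

  removeWeightless : ∀ {n} (w : Weight R (suc n)) i → Weight.w w i ≡ 0# → Weight R n
  removeWeightless {n} w i wi≡0 = record
    { w        = removeAt (Weight.w w) i
    ; w-nonneg = Weight.w-nonneg w ∘ punchIn i
    ; w-le1    = Weight.w-le1 w ∘ punchIn i
    ; w-sum    = begin
        Σ[_] R n (removeAt (Weight.w w) i)     ≡⟨ Σ≡sum n _ ⟩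
        sum (removeAt (Weight.w w) i)          ≡⟨ sum-removeAt (Weight.w w) i wi≡0 ⟩
        sum (Weight.w w)                       ≡⟨ Σ≡sum (suc n) (Weight.w w) ⟨
        Σ[_] R (suc n) (Weight.w w)            ≡⟨ Weight.w-sum w ⟩
        1#                                     ∎ }
    where open ≡-Reasoning

  weightlessVertex⇒reducible : (G : WTG R) → 2 ℕ.≤ WTG.a G → ∀ i → xA G i ≡ 0# → Reducible G
  weightlessVertex⇒reducible G@record { a = suc (suc m) } _ i xi≡0 =
    G′ , (refl , preserves (degC G) (β-by-vertex G) (β-by-vertex G′)
               , preserves (degB G) (γ-by-vertex G) (γ-by-vertex G′))
       , preserves (linkDensity G) (t-by-vertex G) (t-by-vertex G′) , ℕ.≤-refl
    where
    open WTG G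
    G′ : WTG R
    G′ = record G
      { a = suc m ; a≢0 = _ ; AB = removeAt AB i ; AC = removeAt AC i
      ; wA = removeWeightless wA i xi≡0 }

    preserves : ∀ {X X′} (v : Fin (suc (suc m)) → ℝ) → X ≡ sum (λ j → xA G j * v j) →
                X′ ≡ sum (removeAt (λ j → xA G j * v j) i) → X′ ≡ X
    preserves v X≡ X′≡ = trans X′≡ (trans (sum-removeAt (λ j → xA G j * v j) i weightless) (sym X≡))
      where
      weightless : xA G i * v i ≡ 0#
      weightless = trans (cong (_* v i) xi≡0) (zeroˡ (v i))
  weightlessVertex⇒reducible record { a = suc zero } (ℕ.s≤s ()) _ _

  shiftWeight : ∀ {n} (w : Weight R n) (d : Fin n → ℝ) (s : ℝ) →
                sum d ≡ 0# → Fits (Weight.w w) d s → Weight R n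
  shiftWeight {n} w d s Σd≡0 fits = record
    { w        = λ i → Weight.w w i + s * d i
    ; w-nonneg = fits
    ; w-le1    = λ i → subst (_ ≤ᵣ_) total≡1 (summand≤sum _ fits i)
    ; w-sum    = trans (Σ≡sum n _) total≡1 }
    where
    open ≡-Reasoning
    total≡1 : sum (λ i → Weight.w w i + s * d i) ≡ 1#
    total≡1 = begin
      sum (λ i → Weight.w w i + s * d i)         ≡⟨ ∑-distrib-+ (Weight.w w) (λ i → s * d i) ⟩
      sum (Weight.w w) + sum (λ i → s * d i)     ≡⟨ cong₂ _+_ (trans (sym (Σ≡sum n _)) (Weight.w-sum w))
                                                              (sym (*-distribˡ-sum s d)) ⟩
      1# + s * sum d                             ≡⟨ cong (λ z → 1# + s * z) Σd≡0 ⟩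
      1# + s * 0#                                ≡⟨ cong (1# +_) (zeroʳ s) ⟩
      1# + 0#                                    ≡⟨ +-identityʳ 1# ⟩
      1#                                         ∎

  sum-shift : ∀ {n} (x d v : Fin n → ℝ) s → sum (λ i → d i * v i) ≡ 0# →
              sum (λ i → (x i + s * d i) * v i) ≡ sum (λ i → x i * v i)
  sum-shift x d v s Σdv≡0 = begin
    sum (λ i → (x i + s * d i) * v i)                         ≡⟨ sum-linear x d v s ⟩
    sum (λ i → x i * v i) + s * sum (λ i → d i * v i)         ≡⟨ cong (λ z → _ + s * z) Σdv≡0 ⟩
    sum (λ i → x i * v i) + s * 0#                            ≡⟨ cong (sum (λ i → x i * v i) +_) (zeroʳ s) ⟩
    sum (λ i → x i * v i) + 0#                                ≡⟨ +-identityʳ _ ⟩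
    sum (λ i → x i * v i)                                     ∎
    where open ≡-Reasoning

  descent⇒reducible : (G : WTG R) → Extremal R G → 2 ℕ.≤ WTG.a G →
    (rel : NontrivialRelation (profile G)) → sum (λ i → proj₁ rel i * linkDensity G i) ≤ᵣ 0# →
    ¬ ¬ Reducible G
  descent⇒reducible G extremal 2≤a (d , (k , dk≢0) , relation) descent = do
    (j , dj≤0 , dj≢0) ← zeroSum⇒negativeEntry d Σd≡0 k dk≢0
    (s , 0≤s , fits , i , hit) ← boundaryPoint (xA G) d (Weight.w-nonneg (WTG.wA G)) j dj≤0 dj≢0
    pure (moved s 0≤s fits i hit)
    where
    Σd≡0 : sum d ≡ 0#
    Σd≡0 = trans (sum-cong-≗ λ i → sym (*-identityʳ (d i))) (relation zero)

    moved : ∀ s → 0# ≤ᵣ s → Fits (xA G) d s → ∀ i → xA G i + s * d i ≡ 0# → Reducible G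
    moved s 0≤s fits i hit = reducible-via {G} {G₁} inTri t₁≡t refl (weightlessVertex⇒reducible G₁ 2≤a i hit)
      where
      G₁ : WTG R
      G₁ = record G { wA = shiftWeight (WTG.wA G) d s Σd≡0 fits }

      unchanged : ∀ {X X₁} (v : Fin (WTG.a G) → ℝ) → X ≡ sum (λ i → xA G i * v i) →
                  X₁ ≡ sum (λ i → (xA G i + s * d i) * v i) → sum (λ i → d i * v i) ≡ 0# → X₁ ≡ X
      unchanged v X≡ X₁≡ flat = trans X₁≡ (trans (sum-shift (xA G) d v s flat) (sym X≡))

      inTri : InTri R (α R G) (β R G) (γ R G) G₁
      inTri = refl
            , unchanged (degC G) (β-by-vertex G) (β-by-vertex G₁) (relation (suc zero))
            , unchanged (degB G) (γ-by-vertex G) (γ-by-vertex G₁) (relation (suc (suc zero)))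

      t₁≤t : t R G₁ ≤ᵣ t R G
      t₁≤t = begin
        t R G₁                                              ≡⟨ t-by-vertex G₁ ⟩
        sum (λ i → (xA G i + s * d i) * linkDensity G i)    ≡⟨ sum-linear (xA G) d (linkDensity G) s ⟩
        sum (λ i → xA G i * linkDensity G i) + s * D        ≤⟨ +-monoʳ-≤ _ (*-nonneg-nonpos 0≤s descent) ⟩
        sum (λ i → xA G i * linkDensity G i) + 0#          ≡⟨ +-identityʳ _ ⟩
        sum (λ i → xA G i * linkDensity G i)               ≡⟨ t-by-vertex G ⟨
        t R G                                               ∎
        where
        open ≤-Reasoning
        D : ℝ
        D = sum (λ i → d i * linkDensity G i)

      t₁≡t : t R G₁ ≡ t R G
      t₁≡t = antisym t₁≤t (extremal G₁ inTri)

  sum-neg : ∀ {n} (f : Fin n → ℝ) → sum (λ i → - f i) ≡ - sum f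
  sum-neg {zero}  f = sym -0#≈0#
  sum-neg {suc n} f = trans (cong (- f zero +_) (sum-neg (f ∘ suc))) (-‿+-comm _ _)

  sum-neg-* : ∀ {n} (d v : Fin n → ℝ) → sum (λ i → - d i * v i) ≡ - sum (λ i → d i * v i)
  sum-neg-* d v = trans (sum-cong-≗ λ i → sym (-‿distribˡ-* (d i) (v i))) (sum-neg (λ i → d i * v i))

  orient-nonincreasing : ∀ {m n} {v : Fin n → Fin m → ℝ} → NontrivialRelation v → (f : Fin n → ℝ) →
                         Σ (NontrivialRelation v) λ rel → sum (λ i → proj₁ rel i * f i) ≤ᵣ 0#
  orient-nonincreasing {v = v} rel@(d , (k , dk≢0) , relation) f with total (sum (λ i → d i * f i)) 0#
  ... | inj₁ ≤0 = rel , ≤0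
  ... | inj₂ 0≤ = ((λ i → - d i) , (k , -‿nonzero dk≢0) , negated)
                , subst (_≤ᵣ 0#) (sym (sum-neg-* d f)) (neg-nonneg 0≤)
    where
    negated : ∀ c → sum (λ i → - d i * v i c) ≡ 0#
    negated c = trans (sum-neg-* d (λ i → v i c)) (trans (cong -_ (relation c)) -0#≈0#)

  classA≤3 : (G : WTG R) → Extremal R G → VertexMinimal R G → WTG.a G ℕ.≤ 3
  classA≤3 G extremal minimal = ℕ.≮⇒≥ λ 3<a →
    <⇒nontrivialRelation 3<a (profile G) λ rel →
      let (rel′ , descent) = orient-nonincreasing rel (linkDensity G)
      in descent⇒reducible G extremal (ℕ.≤-trans (ℕ.s≤s (ℕ.s≤s ℕ.z≤n)) 3<a) rel′ descent minimal

  -- Rotating the three classes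

  rotate : WTG R → WTG R
  rotate G = record
    { a = b ; b = c ; c = a ; a≢0 = b≢0 ; b≢0 = c≢0 ; c≢0 = a≢0
    ; AB = BC ; AC = λ j i → AB i j ; BC = λ k i → AC i k
    ; wA = wB ; wB = wC ; wC = wA }
    where open WTG G

  module _ (G : WTG R) where
    open WTG G
    private
      xB : Fin b → ℝ
      xB = Weight.w wB
      xC : Fin c → ℝ
      xC = Weight.w wC

    α-rotate : α R (rotate G) ≡ β R G
    α-rotate = sym (trans (Σ-comm a c _) (Σ-cong c λ k → Σ-cong a λ i →
      cong [ AC i k ]·_ (*-comm (xA G i) (xC k))))

    β-rotate : β R (rotate G) ≡ γ R G
    β-rotate = sym (trans (Σ-comm a b _) (Σ-cong b λ j → Σ-cong a λ i →
      cong [ AB i j ]·_ (*-comm (xA G i) (xB j))))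

    t-rotate : t R (rotate G) ≡ t R G
    t-rotate = sym (trans (Σ-comm a b _) (Σ-cong b λ j →
      trans (Σ-comm a c _) (Σ-cong c λ k → Σ-cong a λ i →
        cong₂ [_]·_ (∧-rotate (AB i j) (AC i k) (BC j k))
                    (solve 3 (λ x y z → x :* y :* z := y :* z :* x) refl (xA G i) (xB j) (xC k)))))
      where
      ∧-rotate : ∀ x y z → (x ∧ y ∧ z) ≡ (z ∧ x ∧ y)
      ∧-rotate x y z = trans (sym (Bool.∧-assoc x y z)) (Bool.∧-comm (x ∧ y) z)

    size-rotate : size R (rotate G) ≡ size R G
    size-rotate = trans (ℕ.+-comm (b ℕ.+ c) a) (sym (ℕ.+-assoc a b c))

  rotate-InTri : ∀ G G′ → InTri R (α R (rotate G)) (β R (rotate G)) (γ R (rotate G)) G′ →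
                 InTri R (α R G) (β R G) (γ R G) (rotate (rotate G′))
  rotate-InTri G G′ (α≡ , β≡ , γ≡) =
    trans (α-rotate (rotate G′)) (trans (β-rotate G′) γ≡) ,
    trans (β-rotate (rotate G′)) (trans α≡ (α-rotate G)) ,
    trans (α-rotate G′) (trans β≡ (β-rotate G))

  rotate-Extremal : ∀ G → Extremal R G → Extremal R (rotate G)
  rotate-Extremal G extremal G′ inTri =
    subst₂ _≤ᵣ_ (sym (t-rotate G)) (trans (t-rotate (rotate G′)) (t-rotate G′))
           (extremal (rotate (rotate G′)) (rotate-InTri G G′ inTri))

  rotate-VertexMinimal : ∀ G → VertexMinimal R G → VertexMinimal R (rotate G)
  rotate-VertexMinimal G minimal (G′ , inTri , t≡ , smaller) = minimal
    ( rotate (rotate G′) , rotate-InTri G G′ inTri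
    , trans (trans (t-rotate (rotate G′)) (t-rotate G′)) (trans t≡ (t-rotate G))
    , subst₂ ℕ._<_ (sym (trans (size-rotate (rotate G′)) (size-rotate G′))) (size-rotate G) smaller )

lemma13 : (R : RealField) (G : WTG R) →
    Extremal R G → VertexMinimal R G →
    (WTG.a G ≤ 3) × (WTG.b G ≤ 3) × (WTG.c G ≤ 3)
lemma13 R G extremal minimal =
  classA≤3 R G extremal minimal ,
  classA≤3 R (rotate R G) extremal′ minimal′ ,
  classA≤3 R (rotate R (rotate R G)) (rotate-Extremal R (rotate R G) extremal′)
    (rotate-VertexMinimal R (rotate R G) minimal′)
  where
  extremal′ : Extremal R (rotate R G)
  extremal′ = rotate-Extremal R G extremal
  minimal′ : VertexMinimal R (rotate R G)
  minimal′ = rotate-VertexMinimal R G minimal
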